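{- For every integer $n\ge 1$, $$DP(P_n\circ K_1,x)=x+2^{n-1}x^2.$$
   Context: $P_n$ is the path on $n$ vertices and $P_n\circ K_1$ is the corona, obtained by attaching one new pendant vertex to each vertex of $P_n$. A dominating set of a graph $G$ is a set $S\subseteq V(G)$ such that every vertex outside $S$ has a neighbor in $S$. A domatic partition is a partition of $V(G)$ into nonempty dominating sets; $d(G)$ is the maximum number of parts of one; $dp(G,i)$ is the number of distinct unordered domatic partitions with exactly $i$ parts; and $DP(G,x)=\sum_{i=1}^{d(G)}dp(G,i)x^i$. -}

module Defs where

open import Data.Nat using (ℕ; zero; suc; _+_; _*_; _^_; _∸_; _<_; _≤_; _<?_; _!)

open import Data.Nat.DivMod using (_/_)
open import Data.Nat.Properties using (_≟_; _!≢0)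
open import Data.Fin using (Fin; toℕ)
open import Data.Fin.Properties using (all?; any?) renaming (_≟_ to _≟ᶠ_)
open import Data.List using (List; []; _∷_; [_]; map; concatMap; filter; length)
open import Data.List.Base using ()
open import Data.Fin.Base using ()
open import Data.Bool using (Bool; true; false; T; _∧_; _∨_)
open import Data.Bool.Properties using (T?)
open import Data.Product using (_×_; Σ; ∃; _,_)
open import Data.Sum using (_⊎_)
open import Relation.Binary.PropositionalEquality using (_≡_)
open import Relation.Nullary using (Dec; yes; no)
open import Relation.Nullary.Decidable using (_×-dec_; _⊎-dec_; ⌊_⌋)
import Data.List as L

record Graph : Set where
  field
    order : ℕ
    adj   : Fin order → Fin order → Bool
open Graph public

adjacentNat : ℕ → ℕ → Bool
adjacentNat a b = ⌊ suc a ≟ b ⌋ ∨ ⌊ suc b ≟ a ⌋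

-- The corona P_n ∘ K_1 on 2n vertices: vertices 0..n-1 form the path
-- (k adjacent to k+1), and vertex n+k is the pendant vertex attached to k.
coronaAdjℕ : ℕ → ℕ → ℕ → Bool
coronaAdjℕ n a b =
  (⌊ a <? n ⌋ ∧ ⌊ b <? n ⌋ ∧ adjacentNat a b)
  ∨ (⌊ a <? n ⌋ ∧ ⌊ b ≟ n + a ⌋)
  ∨ (⌊ b <? n ⌋ ∧ ⌊ a ≟ n + b ⌋)

PathCorona : ℕ → Graph
PathCorona n = record { order = n + n ; adj = λ u v → coronaAdjℕ n (toℕ u) (toℕ v) }

Dominating : (G : Graph) → (Fin (order G) → Set) → Set
Dominating G S = ∀ v → S v ⊎ ∃ λ u → T (adj G v u) × S u

-- An ordered domatic partition into exactly i parts: a colouring c : V → Fin i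
-- which is surjective (all i parts nonempty) and each colour class is dominating.
IsOrderedDomatic : (G : Graph) (i : ℕ) → (Fin (order G) → Fin i) → Set
IsOrderedDomatic G i c =
  (∀ k → ∃ λ v → c v ≡ k) × (∀ k → Dominating G (λ v → c v ≡ k))

isOrderedDomatic? : (G : Graph) (i : ℕ) (c : Fin (order G) → Fin i) → Dec (IsOrderedDomatic G i c)
isOrderedDomatic? G i c =
  all? (λ k → any? (λ v → c v ≟ᶠ k))
  ×-dec all? (λ k → all? (λ v → (c v ≟ᶠ k) ⊎-dec any? (λ u → T? (adj G v u) ×-dec (c u ≟ᶠ k))))

allFuns : (m i : ℕ) → List (Fin m → Fin i)
allFuns zero    i = [ (λ ()) ]
allFuns (suc m) i = concatMap (λ f → map (λ c → ext c f) (L.allFin i)) (allFuns m i)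
  where
  ext : Fin i → (Fin m → Fin i) → Fin (suc m) → Fin i
  ext c f Fin.zero    = c
  ext c f (Fin.suc k) = f k

orderedDomaticCount : Graph → ℕ → ℕ
orderedDomaticCount G i = length (filter (isOrderedDomatic? G i) (allFuns (order G) i))

-- Each unordered partition into i nonempty parts corresponds to exactly i!
-- labelled ones, so dp(G,i) = (ordered count) / i!  (exact division).
dp : Graph → ℕ → ℕ
dp G i = _/_ (orderedDomaticCount G i) (i !) ⦃ i !≢0 ⦄

-- d(G) = max { i | dp(G,i) > 0 } ; since dp(G,i) = 0 for every i > d(G),
-- the coefficient of x^i in DP(G,x) = Σ_{i=1}^{d(G)} dp(G,i) x^i is
-- dp(G,i) for i ≥ 1 and 0 for i = 0.
DPcoeff : Graph → ℕ → ℕ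
DPcoeff G zero    = 0
DPcoeff G (suc i) = dp G (suc i)

targetCoeff : ℕ → ℕ → ℕ
targetCoeff n 1 = 1
targetCoeff n 2 = 2 ^ (n ∸ 1)
targetCoeff n _ = 0

{-# OPTIONS --safe #-}
-- The pendant vertex n + k of P_n ∘ K₁ has k as its only neighbour, so every dominating set
-- meets {k, n + k}.  Hence a domatic partition has at most two parts, and a 2-colouring is
-- domatic exactly when k and n + k get different colours for every k (then every vertex has
-- a neighbour of the other colour).  Such colourings are determined by their values on the
-- path, so there are 2^n ordered and 2^(n-1) unordered ones; the single-part partition
-- contributes the coefficient of x.
module Submission where

open import Defs
open import Data.Bool using (Bool; true; false; T; _∧_)
open import Data.Fin using (Fin; zero; suc; toℕ; _↑ˡ_; _↑ʳ_; splitAt; join)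
open import Data.Fin.Patterns using (0F; 1F; 2F)
open import Data.Fin.Properties
  using (all?; toℕ-injective; toℕ<n; toℕ-↑ˡ; toℕ-↑ʳ; join-splitAt) renaming (_≟_ to _≟ᶠ_)
import Data.List as L
open import Data.List using (List; []; _∷_; map; concatMap; filter; length; allFin)
open import Data.List.Properties using (map-++; map-cong; map-∘; filter-all; filter-none; filter-≐; length-tabulate)
open import Data.List.Relation.Unary.All using (universal)
open import Data.Nat using (ℕ; zero; suc; _+_; _*_; _^_; _<_; _<?_; _≤_; _!)
open import Data.Nat.DivMod using (_/_; m*n/n≡m)
open import Data.Nat.ListAction using (sum)
open import Data.Nat.ListAction.Properties using (sum-++)
open import Data.Nat.Properties
  using (_≟_; _!≢0; +-identityʳ; *-identityˡ; *-identityʳ; *-zeroʳ; *-comm; *-distribˡ-+; *-distribʳ-+;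
         ^-zeroˡ; +-cancelˡ-≡; m+n≮m)
open import Data.Product using (∃; _×_; _,_; proj₁; proj₂)
open import Data.Sum using (_⊎_; inj₁; inj₂; [_,_]′)
open import Data.Sum.Properties using ([,]-map)
open import Data.Unit using (tt)
import Data.Vec.Functional as V
open import Data.Vec.Functional.Properties using (∷-cong; ++-cong; lookup-++ˡ; lookup-++ʳ)
open import Function using (_∘_; id; _⇔_; mk⇔; Equivalence)
open import Level using (Level)
open import Relation.Binary.Core using (_Preserves_⟶_)
open import Relation.Binary.Definitions using (_Respects_)
open import Relation.Binary.PropositionalEquality
open import Relation.Nullary using (¬_; yes; no; does; contradiction; ¬?)
open import Relation.Nullary.Decidable using (does-⇔)
open import Relation.Unary using (Pred; Decidable; U)
open import Relation.Unary.Properties using (U?)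
open ≡-Reasoning

private
  variable
    p : Level
    A B : Set
    a b i m r : ℕ

count : {P : Pred A p} → Decidable P → List A → ℕ
count P? = length ∘ filter P?

indicator : Bool → ℕ
indicator true  = 1
indicator false = 0

indicator-∧ : ∀ x y → indicator (x ∧ y) ≡ indicator x * indicator y
indicator-∧ true  y = sym (*-identityˡ (indicator y))
indicator-∧ false y = refl

count≡sum-indicator : {P : Pred A p} (P? : Decidable P) (xs : List A) →
                      count P? xs ≡ sum (map (indicator ∘ does ∘ P?) xs)
count≡sum-indicator P? []       = refl
count≡sum-indicator P? (x ∷ xs) with does (P? x)
... | true  = cong (1 +_) (count≡sum-indicator P? xs)
... | false = count≡sum-indicator P? xs

count-universal : {P : Pred A p} (P? : Decidable P) → (∀ x → P x) → ∀ xs → count P? xs ≡ length xs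
count-universal P? all-P xs = cong length (filter-all P? (universal all-P xs))

count-⇔ : {P Q : Pred A p} (P? : Decidable P) (Q? : Decidable Q) → (∀ x → P x ⇔ Q x) →
          ∀ xs → count P? xs ≡ count Q? xs
count-⇔ P? Q? P⇔Q xs =
  cong length (filter-≐ P? Q? ((λ {x} → Equivalence.to (P⇔Q x)) , (λ {x} → Equivalence.from (P⇔Q x))) xs)

indicator-respects : {P : Pred (A → B) p} (P? : Decidable P) → P Respects _≗_ →
                     (indicator ∘ does ∘ P?) Preserves _≗_ ⟶ _≡_
indicator-respects P? P-resp f≗g = cong indicator (does-⇔ (mk⇔ (P-resp f≗g) (P-resp (sym ∘ f≗g))) (P? _) (P? _))

sum-map-cong : {f g : A → ℕ} → (∀ x → f x ≡ g x) → ∀ xs → sum (map f xs) ≡ sum (map g xs)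
sum-map-cong f≗g xs = cong sum (map-cong f≗g xs)

sum-map-concatMap : (h : B → ℕ) (g : A → List B) (xs : List A) →
                    sum (map h (concatMap g xs)) ≡ sum (map (λ x → sum (map h (g x))) xs)
sum-map-concatMap h g []       = refl
sum-map-concatMap h g (x ∷ xs) = begin
  sum (map h (g x L.++ concatMap g xs))                  ≡⟨ cong sum (map-++ h (g x) _) ⟩
  sum (map h (g x) L.++ map h (concatMap g xs))          ≡⟨ sum-++ (map h (g x)) _ ⟩
  sum (map h (g x)) + sum (map h (concatMap g xs))        ≡⟨ cong (sum (map h (g x)) +_) (sum-map-concatMap h g xs) ⟩
  sum (map h (g x)) + sum (map (λ x → sum (map h (g x))) xs) ∎

sum-map-*ˡ : ∀ k (h : A → ℕ) xs → sum (map (λ x → k * h x) xs) ≡ k * sum (map h xs)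
sum-map-*ˡ k h []       = sym (*-zeroʳ k)
sum-map-*ˡ k h (x ∷ xs) = trans (cong (k * h x +_) (sum-map-*ˡ k h xs)) (sym (*-distribˡ-+ k (h x) _))

sum-map-*ʳ : ∀ k (h : A → ℕ) xs → sum (map (λ x → h x * k) xs) ≡ sum (map h xs) * k
sum-map-*ʳ k h []       = refl
sum-map-*ʳ k h (x ∷ xs) = trans (cong (h x * k +_) (sum-map-*ʳ k h xs)) (sym (*-distribʳ-+ k (h x) _))

sum-map-const : ∀ k (xs : List A) → sum (map (λ _ → k) xs) ≡ length xs * k
sum-map-const k []       = refl
sum-map-const k (x ∷ xs) = cong (k +_) (sum-map-const k xs)

-- The elements of allFuns (suc m) i are built by the where-bound ext of allFuns, which agrees
-- with c V.∷ f only pointwise; hence the summands are required to respect _≗_.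
sum-allFuns-suc : (h : (Fin (suc m) → Fin i) → ℕ) → h Preserves _≗_ ⟶ _≡_ →
                  sum (map h (allFuns (suc m) i))
                    ≡ sum (map (λ f → sum (map (λ c → h (c V.∷ f)) (allFin i))) (allFuns m i))
sum-allFuns-suc {m} {i} h h-cong = trans (sum-map-concatMap h _ (allFuns m i)) (sum-map-cong row (allFuns m i))
  where
  row : ∀ f → sum (map h (map _ (allFin i))) ≡ sum (map (λ c → h (c V.∷ f)) (allFin i))
  row f = trans (cong sum (sym (map-∘ (allFin i)))) (sum-map-cong (λ c → h-cong (∷-cong refl (λ _ → refl))) (allFin i))

∷-++ : ∀ {a b} (c : A) (u : V.Vector A a) (v : V.Vector A b) → (c V.∷ u) V.++ v ≗ c V.∷ (u V.++ v)
∷-++ {a = a} c u v = ∷-cong refl (λ k → [,]-map (splitAt a k))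

sum-allFuns-++ : ∀ a {b i} (h : (Fin (a + b) → Fin i) → ℕ) → h Preserves _≗_ ⟶ _≡_ →
                 sum (map h (allFuns (a + b) i))
                   ≡ sum (map (λ v → sum (map (λ u → h (u V.++ v)) (allFuns a i))) (allFuns b i))
sum-allFuns-++ zero    {b} h h-cong = sum-map-cong (λ v → sym (+-identityʳ (h v))) (allFuns b _)
sum-allFuns-++ (suc a) {b} {i} h h-cong = begin
  sum (map h (allFuns (suc a + b) i))
    ≡⟨ sum-allFuns-suc h h-cong ⟩
  sum (map h-∷ (allFuns (a + b) i))
    ≡⟨ sum-allFuns-++ a h-∷ (λ f≗g → sum-map-cong (λ c → h-cong (∷-cong refl f≗g)) (allFin i)) ⟩
  sum (map (λ v → sum (map (λ u → h-∷ (u V.++ v)) (allFuns a i))) (allFuns b i))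
    ≡⟨ sum-map-cong split-head (allFuns b i) ⟨
  sum (map (λ v → sum (map (λ u → h (u V.++ v)) (allFuns (suc a) i))) (allFuns b i)) ∎
  where
  h-∷ : (Fin (a + b) → Fin i) → ℕ
  h-∷ f = sum (map (λ c → h (c V.∷ f)) (allFin i))

  split-head : ∀ v → sum (map (λ u → h (u V.++ v)) (allFuns (suc a) i))
                     ≡ sum (map (λ u → h-∷ (u V.++ v)) (allFuns a i))
  split-head v = trans (sum-allFuns-suc (λ u → h (u V.++ v)) (λ u≗u′ → h-cong (++-cong _ _ u≗u′ (λ _ → refl))))
                       (sum-map-cong (λ u → sum-map-cong (λ c → h-cong (∷-++ c u v)) (allFin i)) (allFuns a i))

count-allFuns-pointwise : ∀ m {i r} {R : Fin m → Pred (Fin i) p} (R? : ∀ k → Decidable (R k)) →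
                          (∀ k → count (R? k) (allFin i) ≡ r) →
                          count (λ u → all? (λ k → R? k (u k))) (allFuns m i) ≡ r ^ m
count-allFuns-pointwise zero    R? counts = refl
count-allFuns-pointwise (suc m) {i} {r} {R} R? counts = begin
  count (λ u → all? (λ k → R? k (u k))) (allFuns (suc m) i)
    ≡⟨ count≡sum-indicator _ (allFuns (suc m) i) ⟩
  sum (map (λ u → indicator (does (all? (λ k → R? k (u k))))) (allFuns (suc m) i))
    -- does (all? P?) unfolds definitionally to does (P? zero) ∧ does (all? (P? ∘ suc))
    ≡⟨ sum-allFuns-suc _ (indicator-respects (λ u → all? (λ k → R? k (u k))) R-pointwise) ⟩
  sum (map (λ f → sum (map (λ c → indicator (does (R? zero c) ∧ does (all? (λ k → R? (suc k) (f k)))))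
                           (allFin i)))
           (allFuns m i))
    ≡⟨ sum-map-cong row (allFuns m i) ⟩
  sum (map (λ f → r * indicator (does (all? (λ k → R? (suc k) (f k))))) (allFuns m i))
    ≡⟨ sum-map-*ˡ r _ (allFuns m i) ⟩
  r * sum (map (λ f → indicator (does (all? (λ k → R? (suc k) (f k))))) (allFuns m i))
    ≡⟨ cong (r *_) (sym (count≡sum-indicator _ (allFuns m i))) ⟩
  r * count (λ f → all? (λ k → R? (suc k) (f k))) (allFuns m i)
    ≡⟨ cong (r *_) (count-allFuns-pointwise m (R? ∘ suc) (counts ∘ suc)) ⟩
  r * r ^ m ∎
  where
  R-pointwise : (λ (u : Fin (suc m) → Fin i) → ∀ k → R k (u k)) Respects _≗_
  R-pointwise u≗u′ Ru k = subst (R k) (u≗u′ k) (Ru k)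

  row : ∀ f → sum (map (λ c → indicator (does (R? zero c) ∧ does (all? (λ k → R? (suc k) (f k))))) (allFin i))
              ≡ r * indicator (does (all? (λ k → R? (suc k) (f k))))
  row f = begin
    _ ≡⟨ sum-map-cong (λ c → indicator-∧ (does (R? zero c)) _) (allFin i) ⟩
    _ ≡⟨ sum-map-*ʳ _ (indicator ∘ does ∘ R? zero) (allFin i) ⟩
    _ ≡⟨ cong (_* _) (trans (sym (count≡sum-indicator (R? zero) (allFin i))) (counts zero)) ⟩
    _ ∎

length-allFuns : ∀ m i → length (allFuns m i) ≡ i ^ m
length-allFuns m i = begin
  length (allFuns m i)             ≡⟨ count-universal everywhere? (λ _ _ → tt) (allFuns m i) ⟨
  count everywhere? (allFuns m i)  ≡⟨ count-allFuns-pointwise m (λ _ → U?) (λ _ → length-allFin) ⟩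
  i ^ m                            ∎
  where
  everywhere? : Decidable (λ (u : Fin m → Fin i) → ∀ k → U (u k))
  everywhere? u = all? (λ k → U? (u k))
  length-allFin : count U? (allFin i) ≡ i
  length-allFin = trans (count-universal U? (λ _ → tt) (allFin i)) (length-tabulate _)

count-allFuns-++ : ∀ a b {i r} {P : Pred (Fin (a + b) → Fin i) p} (P? : Decidable P) →
                   P Respects _≗_ →
                   (∀ v → count (λ u → P? (u V.++ v)) (allFuns a i) ≡ r) →
                   count P? (allFuns (a + b) i) ≡ i ^ b * r
count-allFuns-++ a b {i} {r} P? P-resp fibre = begin
  count P? (allFuns (a + b) i)
    ≡⟨ count≡sum-indicator P? (allFuns (a + b) i) ⟩
  sum (map (indicator ∘ does ∘ P?) (allFuns (a + b) i))
    ≡⟨ sum-allFuns-++ a _ (indicator-respects P? P-resp) ⟩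
  sum (map (λ v → sum (map (λ u → indicator (does (P? (u V.++ v)))) (allFuns a i))) (allFuns b i))
    ≡⟨ sum-map-cong (λ v → trans (sym (count≡sum-indicator _ (allFuns a i))) (fibre v)) (allFuns b i) ⟩
  sum (map (λ _ → r) (allFuns b i))
    ≡⟨ sum-map-const r (allFuns b i) ⟩
  length (allFuns b i) * r
    ≡⟨ cong (_* r) (length-allFuns b i) ⟩
  i ^ b * r ∎

≢⇒cover : {x y : Fin 2} → x ≢ y → ∀ z → x ≡ z ⊎ y ≡ z
≢⇒cover {0F} {0F} x≢y _  = contradiction refl x≢y
≢⇒cover {1F} {1F} x≢y _  = contradiction refl x≢y
≢⇒cover {0F} {1F} _   0F = inj₁ refl
≢⇒cover {0F} {1F} _   1F = inj₂ refl
≢⇒cover {1F} {0F} _   0F = inj₂ refl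
≢⇒cover {1F} {0F} _   1F = inj₁ refl

¬-two-cover : ∀ {j} {x y : Fin (3 + j)} → ¬ (∀ z → x ≡ z ⊎ y ≡ z)
¬-two-cover cover with cover 0F | cover 1F | cover 2F
... | inj₁ p | inj₁ q | _      = contradiction (trans (sym p) q) λ ()
... | inj₂ p | inj₂ q | _      = contradiction (trans (sym p) q) λ ()
... | inj₁ p | inj₂ _ | inj₁ q = contradiction (trans (sym p) q) λ ()
... | inj₂ p | inj₁ _ | inj₂ q = contradiction (trans (sym p) q) λ ()
... | inj₁ _ | inj₂ p | inj₂ q = contradiction (trans (sym p) q) λ ()
... | inj₂ _ | inj₁ p | inj₁ q = contradiction (trans (sym p) q) λ ()

count-≢-allFin2 : ∀ y → count (λ x → ¬? (x ≟ᶠ y)) (allFin 2) ≡ 1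
count-≢-allFin2 0F = refl
count-≢-allFin2 1F = refl

-- In PathCorona n, k ↑ˡ n is the path vertex k and n ↑ʳ k its pendant vertex n + k.
HalvesDiffer : ∀ n → (Fin (n + n) → Fin 2) → Set
HalvesDiffer n c = ∀ k → c (k ↑ˡ n) ≢ c (n ↑ʳ k)

halvesDiffer? : ∀ n → Decidable (HalvesDiffer n)
halvesDiffer? n c = all? (λ k → ¬? (c (k ↑ˡ n) ≟ᶠ c (n ↑ʳ k)))

halvesDiffer-++ : ∀ {n} (u v : Fin n → Fin 2) → HalvesDiffer n (u V.++ v) ⇔ (∀ k → u k ≢ v k)
halvesDiffer-++ u v = mk⇔ (λ differ k → differ k ∘ subst₂ _≡_ (sym (lookup-++ˡ u v k)) (sym (lookup-++ʳ u v k)))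
                          (λ differ k → differ k ∘ subst₂ _≡_ (lookup-++ˡ u v k) (lookup-++ʳ u v k))

-- For each colouring v of the right half, the only compatible left half is its complement.
count-halvesDiffer : ∀ n → count (halvesDiffer? n) (allFuns (n + n) 2) ≡ 2 ^ n
count-halvesDiffer n = trans (count-allFuns-++ n n (halvesDiffer? n) respects fibre) (*-identityʳ (2 ^ n))
  where
  respects : HalvesDiffer n Respects _≗_
  respects c≗c′ differ k eq = differ k (trans (c≗c′ _) (trans eq (sym (c≗c′ _))))

  fibre : ∀ v → count (λ u → halvesDiffer? n (u V.++ v)) (allFuns n 2) ≡ 1
  fibre v = begin
    count (λ u → halvesDiffer? n (u V.++ v)) (allFuns n 2)
      ≡⟨ count-⇔ _ _ (λ u → halvesDiffer-++ u v) (allFuns n 2) ⟩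
    count (λ u → all? (λ k → ¬? (u k ≟ᶠ v k))) (allFuns n 2)
      ≡⟨ count-allFuns-pointwise n (λ k x → ¬? (x ≟ᶠ v k)) (count-≢-allFin2 ∘ v) ⟩
    1 ^ n
      ≡⟨ ^-zeroˡ n ⟩
    1 ∎

module _ {G : Graph} where

  pendant-or-neighbour : ∀ {S : Fin (order G) → Set} {v u} → Dominating G S →
                         (∀ w → T (adj G v w) → w ≡ u) → S v ⊎ S u
  pendant-or-neighbour {S} {v} dom unique with dom v
  ... | inj₁ Sv              = inj₁ Sv
  ... | inj₂ (w , v~w , Sw) = inj₂ (subst S (unique w v~w) Sw)

  pendant-colours : ∀ {i c v u} → IsOrderedDomatic G i c → (∀ w → T (adj G v w) → w ≡ u) →
                    ∀ j → c v ≡ j ⊎ c u ≡ j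
  pendant-colours (_ , dom) unique j = pendant-or-neighbour (dom j) unique

  two-colouring-dominating : (c : Fin (order G) → Fin 2) → (∀ v → ∃ λ u → T (adj G v u) × c u ≢ c v) →
                             ∀ j → Dominating G (λ v → c v ≡ j)
  two-colouring-dominating c other j v with c v ≟ᶠ j | other v
  ... | yes cv≡j | _                = inj₁ cv≡j
  ... | no cv≢j  | u , v~u , cu≢cv =
    inj₂ (u , v~u , [ id , (λ cv≡j → contradiction cv≡j cv≢j) ]′ (≢⇒cover cu≢cv j))

  trivial-domatic : Fin (order G) → (c : Fin (order G) → Fin 1) → IsOrderedDomatic G 1 c
  trivial-domatic v c = (λ { 0F → v , Fin1-unique (c v) }) , (λ { 0F w → inj₁ (Fin1-unique (c w)) })
    where
    Fin1-unique : (x : Fin 1) → x ≡ 0F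
    Fin1-unique 0F = refl

  orderedDomaticCount-one : Fin (order G) → orderedDomaticCount G 1 ≡ 1
  orderedDomaticCount-one v = begin
    orderedDomaticCount G 1
      ≡⟨ count-universal (isOrderedDomatic? G 1) (trivial-domatic v) (allFuns (order G) 1) ⟩
    length (allFuns (order G) 1)
      ≡⟨ length-allFuns (order G) 1 ⟩
    1 ^ order G
      ≡⟨ ^-zeroˡ (order G) ⟩
    1 ∎

-- Both proofs abstract over exactly the decisions occurring in coronaAdjℕ, so that the
-- Boolean adjacency computes in each branch.
pendant-neighbourℕ : ∀ n t w → T (coronaAdjℕ n (n + t) w) → w ≡ t
pendant-neighbourℕ n t w adjacent with n + t <? n | w <? n | n + t ≟ n + w
... | yes n+t<n | _     | _      = contradiction n+t<n (m+n≮m n t)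
... | no _      | _     | yes eq = sym (+-cancelˡ-≡ n t w eq)
pendant-neighbourℕ n t w () | no _ | yes _ | no _
pendant-neighbourℕ n t w () | no _ | no _  | no _

pendant-edgeℕ : ∀ n t → t < n → T (coronaAdjℕ n t (n + t)) × T (coronaAdjℕ n (n + t) t)
pendant-edgeℕ n t t<n with t <? n | n + t <? n | n + t ≟ n + t
... | no t≮n | _         | _        = contradiction t<n t≮n
... | _      | yes n+t<n | _        = contradiction n+t<n (m+n≮m n t)
... | _      | _         | no ¬refl = contradiction refl ¬refl
... | yes _  | no _      | yes _    = tt , tt

module _ {n : ℕ} where

  pendant-neighbour : (k : Fin n) → ∀ w → T (adj (PathCorona n) (n ↑ʳ k) w) → w ≡ k ↑ˡ n
  pendant-neighbour k w adjacent = toℕ-injective (begin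
    toℕ w        ≡⟨ pendant-neighbourℕ n (toℕ k) (toℕ w)
                      (subst (λ a → T (coronaAdjℕ n a (toℕ w))) (toℕ-↑ʳ n k) adjacent) ⟩
    toℕ k        ≡⟨ toℕ-↑ˡ k n ⟨
    toℕ (k ↑ˡ n) ∎)

  pendant-edge : (k : Fin n) → T (adj (PathCorona n) (k ↑ˡ n) (n ↑ʳ k)) × T (adj (PathCorona n) (n ↑ʳ k) (k ↑ˡ n))
  pendant-edge k = subst₂ (λ a b → T (coronaAdjℕ n a b) × T (coronaAdjℕ n b a))
                          (sym (toℕ-↑ˡ k n)) (sym (toℕ-↑ʳ n k)) (pendant-edgeℕ n (toℕ k) (toℕ<n k))

  pendant-pair-colours : ∀ {i c} → IsOrderedDomatic (PathCorona n) i c →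
                         ∀ (k : Fin n) j → c (n ↑ʳ k) ≡ j ⊎ c (k ↑ˡ n) ≡ j
  pendant-pair-colours d k = pendant-colours {v = n ↑ʳ k} {u = k ↑ˡ n} d (pendant-neighbour k)

  other-coloured-neighbour : (c : Fin (n + n) → Fin 2) → HalvesDiffer n c →
                             ∀ v → ∃ λ u → T (adj (PathCorona n) v u) × c u ≢ c v
  other-coloured-neighbour c differ v = subst Good (join-splitAt n n v) (by-half (splitAt n v))
    where
    Good : Fin (n + n) → Set
    Good v = ∃ λ u → T (adj (PathCorona n) v u) × c u ≢ c v
    by-half : ∀ s → Good (join n n s)
    by-half (inj₁ k) = n ↑ʳ k , proj₁ (pendant-edge k) , differ k ∘ sym
    by-half (inj₂ k) = k ↑ˡ n , proj₂ (pendant-edge k) , differ k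

two-domatic⇔halvesDiffer : ∀ m (c : Fin (suc m + suc m) → Fin 2) →
                           IsOrderedDomatic (PathCorona (suc m)) 2 c ⇔ HalvesDiffer (suc m) c
two-domatic⇔halvesDiffer m c = mk⇔ differ domatic
  where
  differ : IsOrderedDomatic (PathCorona (suc m)) 2 c → HalvesDiffer (suc m) c
  differ d k same = contradiction (trans (sym (only 0F)) (only 1F)) λ ()
    where
    only : ∀ j → c (suc m ↑ʳ k) ≡ j
    only j = [ id , trans (sym same) ]′ (pendant-pair-colours d k j)
  domatic : HalvesDiffer (suc m) c → IsOrderedDomatic (PathCorona (suc m)) 2 c
  domatic halves = (λ j → [ (λ eq → _ , eq) , (λ eq → _ , eq) ]′ (≢⇒cover (halves 0F) j))
                 , two-colouring-dominating c (other-coloured-neighbour c halves)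

no-domatic-≥3 : ∀ m j c → ¬ IsOrderedDomatic (PathCorona (suc m)) (3 + j) c
no-domatic-≥3 m j c d = ¬-two-cover (pendant-pair-colours d 0F)

dp-≡ : ∀ G i k → orderedDomaticCount G i ≡ k * i ! → dp G i ≡ k
dp-≡ G i k count≡ = trans (cong (λ x → _/_ x (i !) ⦃ i !≢0 ⦄) count≡) (m*n/n≡m k (i !) ⦃ i !≢0 ⦄)

orderedDomaticCount-two : ∀ m → orderedDomaticCount (PathCorona (suc m)) 2 ≡ 2 ^ suc m
orderedDomaticCount-two m = begin
  orderedDomaticCount (PathCorona (suc m)) 2
    ≡⟨ count-⇔ _ (halvesDiffer? (suc m)) (two-domatic⇔halvesDiffer m) (allFuns (suc m + suc m) 2) ⟩
  count (halvesDiffer? (suc m)) (allFuns (suc m + suc m) 2)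
    ≡⟨ count-halvesDiffer (suc m) ⟩
  2 ^ suc m ∎

orderedDomaticCount-≥3 : ∀ m j → orderedDomaticCount (PathCorona (suc m)) (3 + j) ≡ 0
orderedDomaticCount-≥3 m j =
  cong length (filter-none (isOrderedDomatic? _ (3 + j))
                           (universal (no-domatic-≥3 m j) (allFuns (suc m + suc m) (3 + j))))

mainTheorem8 : (n : ℕ) → 1 ≤ n → (i : ℕ) → DPcoeff (PathCorona n) i ≡ targetCoeff n i
mainTheorem8 (suc m) _ 0 = refl
mainTheorem8 (suc m) _ 1 = dp-≡ (PathCorona (suc m)) 1 1 (orderedDomaticCount-one {PathCorona (suc m)} 0F)
mainTheorem8 (suc m) _ 2 = dp-≡ (PathCorona (suc m)) 2 (2 ^ m) (trans (orderedDomaticCount-two m) (*-comm 2 (2 ^ m)))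
mainTheorem8 (suc m) _ (suc (suc (suc j))) = dp-≡ (PathCorona (suc m)) (3 + j) 0 (orderedDomaticCount-≥3 m j)
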